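{- Run the main algorithm (described in the context) on any instance. Then every batch $X$ it creates satisfies: (1) if $t(X)\ge1$ then $|\widetilde{S}(X)|=B_{t(X)-1}$, and if $t(X)=0$ then $|\widetilde{S}(X)|=1$; and (2) every job $j\in\widetilde{S}(X)$ satisfies $[r_j,d_j]\subseteq\widetilde{I}(X)$.
   Context: Machine types are indexed $k=0,1,2,\dots$ with capacities $B_0<B_1<\cdots$ (positive integers) and costs $c_k=2^k$; unlimited machines of each type. Unit-length jobs $j$ arrive online with integer release time $r_j$ and integer deadline $d_j\ge r_j$, revealed at time $r_j$. A batch $X$ has a job set $J(X)$, type $t(X)$, execution time $\tau(X)$, with $|J(X)|\le B_{t(X)}$ and $r_j\le\tau(X)\le d_j$ for $j\in J(X)$. Main algorithm: maintain the set $\mathcal{X}$ of batches created so far and the set $W$ of released but not yet executed jobs. For $\tau=0,1,2,\dots$: add the jobs released at $\tau$ to $W$; while some job of $W$ has deadline $\tau$, pick one such job $j^*$ (arbitrarily), create a batch $X^*$ by the subroutine below, add it to $\mathcal{X}$ and remove $J(X^*)$ from $W$. The job $j^*$ is called the critical job of $X^*$; the other jobs of $J(X^*)$ are its non-critical jobs. Subroutine: set $k\leftarrow0$ and $I_0\leftarrow[r_{j^*},\tau]$. While $I_k$ contains the execution time of some batch of $\mathcal{X}$ of type $k$: let $X_k$ be such a batch with the latest execution time $\tau_k=\tau(X_k)$ in $I_k$, let $\tau'_k$ be the earliest release time of a job in $J(X_k)$, set $I_{k+1}\leftarrow I_k\cup[\tau'_k,\tau_k]$, and $k\leftarrow k+1$.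 When the loop stops, set $\widetilde{I}(X^*)\leftarrow I_k$, and let $\widetilde{S}(X^*)$ consist of $j^*$ together with, if $k>0$, all non-critical jobs of $X_{k-1}$. The batch $X^*$ has type $t(X^*)=k$, execution time $\tau(X^*)=\tau$, and $J(X^*)$ equal to the $\min(B_k,|W|)$ jobs of $W$ with earliest deadlines (earliest deadline first), ties broken so that $j^*\in J(X^*)$. -}

module Defs where

open import Data.Nat using (ℕ; zero; suc; _≤_; _<_; _⊓_; _⊔_)
open import Data.Fin using (Fin)
open import Data.Fin.Subset using (Subset; ⁅_⁆; _∪_; _─_; _-_; ∣_∣; ⊥; _⊆_) renaming (_∈_ to _∈ₛ_; _∉_ to _∉ₛ_)
open import Data.Vec using (tabulate)
open import Data.Bool using (Bool; true; false)
open import Data.List using (List; []; _∷_; _++_; [_])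
open import Data.List.Membership.Propositional using () renaming (_∈_ to _∈ₗ_)
open import Data.Maybe using (Maybe; just; nothing)
open import Data.Empty renaming (⊥ to Empty)
open import Relation.Binary.PropositionalEquality using (_≡_; _≢_)
open import Relation.Nullary.Decidable using (⌊_⌋)
import Data.Nat as N
open import Data.Product using (Σ; _×_; _,_)

-- Besides J(X), t(X), τ(X) we record the critical job and the
-- auxiliary data Ĩ(X) = [Ilo, Ihi] and S̃(X) computed by the subroutine.
record Batch (n : ℕ) : Set where
  constructor mkBatch
  field
    crit  : Fin n
    jobs  : Subset n
    type  : ℕ
    time  : ℕ
    Ilo   : ℕ
    Ihi   : ℕ
    Stil  : Subset n
open Batch public

-- State of the main algorithm at the moment the while-loop at time τ is
-- running (jobs released at τ have already been added to W).
record State (n : ℕ) : Set where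
  constructor ⟨_,_,_⟩
  field
    now     : ℕ
    waiting : Subset n
    created : List (Batch n)
open State public

-- The instance: n jobs with release times r and deadlines d,
-- capacities B k of machine type k.
module Algo (n : ℕ) (r d : Fin n → ℕ) (B : ℕ → ℕ) where

  releasedAt : ℕ → Subset n
  releasedAt t = tabulate (λ j → ⌊ r j N.≟ t ⌋)

  nonCritical : Batch n → Subset n
  nonCritical X = jobs X - crit X

  nonCriticalPrev : Maybe (Batch n) → Subset n
  nonCriticalPrev nothing  = ⊥
  nonCriticalPrev (just X) = nonCritical X

  EarliestRelease : Subset n → ℕ → Set
  EarliestRelease J t = (Σ (Fin n) λ j → (j ∈ₛ J) × (r j ≡ t))
                        × (∀ j → j ∈ₛ J → t ≤ r j)

  InWindow : Batch n → ℕ → ℕ → ℕ → Set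
  InWindow X k lo hi = (type X ≡ k) × (lo ≤ time X) × (time X ≤ hi)

  -- The while-loop of the subroutine, as a (nondeterministic) relation:
  -- Loop 𝒳 k lo hi prev k' lo' hi' prev' : starting from the loop state
  -- (k, I_k = [lo,hi], X_{k-1} = prev) the loop may terminate in
  -- (k', [lo',hi'], prev').  All arbitrary choices (ties) are allowed.
  data Loop (𝒳 : List (Batch n)) : ℕ → ℕ → ℕ → Maybe (Batch n)
                                 → ℕ → ℕ → ℕ → Maybe (Batch n) → Set where
    stop : ∀ {k lo hi prev} →
           (∀ Y → Y ∈ₗ 𝒳 → InWindow Y k lo hi → Empty) →
           Loop 𝒳 k lo hi prev k lo hi prev
    step : ∀ {k lo hi prev k' lo' hi' prev'} (X : Batch n) (τ' : ℕ) →
           X ∈ₗ 𝒳 → InWindow X k lo hi →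
           (∀ Y → Y ∈ₗ 𝒳 → InWindow Y k lo hi → time Y ≤ time X) →
           EarliestRelease (jobs X) τ' →
           -- I_{k+1} = I_k ∪ [τ' , τ(X)]  (an interval since τ(X) ∈ I_k)
           Loop 𝒳 (suc k) (lo ⊓ τ') (hi ⊔ time X) (just X) k' lo' hi' prev' →
           Loop 𝒳 k lo hi prev k' lo' hi' prev'

  data Reachable : State n → Set where
    init : Reachable ⟨ 0 , releasedAt 0 , [] ⟩
    advance : ∀ {τ W 𝒳} → Reachable ⟨ τ , W , 𝒳 ⟩ →
              (∀ j → j ∈ₛ W → d j ≢ τ) →
              Reachable ⟨ suc τ , W ∪ releasedAt (suc τ) , 𝒳 ⟩
    batch : ∀ {τ W 𝒳} → Reachable ⟨ τ , W , 𝒳 ⟩ →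
            (j* : Fin n) → j* ∈ₛ W → d j* ≡ τ →
            (k lo hi : ℕ) (prev : Maybe (Batch n)) →
            Loop 𝒳 0 (r j*) τ nothing k lo hi prev →
            (J : Subset n) → J ⊆ W → j* ∈ₛ J →
            ∣ J ∣ ≡ B k ⊓ ∣ W ∣ →
            (∀ i i' → i ∈ₛ J → i' ∈ₛ W → i' ∉ₛ J → d i ≤ d i') →
            Reachable ⟨ τ , W ─ J
                      , 𝒳 ++ [ mkBatch j* J k τ lo hi (⁅ j* ⁆ ∪ nonCriticalPrev prev) ] ⟩

-- The algorithm maintains the following invariant: every executed batch Y is
-- full and earliest-deadline-first with respect to every job released by τ(Y)
-- and still unexecuted after τ(Y) (otherwise that job would have been put into
-- Y).  While the subroutine runs at time τ for the critical job j*, every time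
-- t in the current window I_k is covered by a job released by t, due by τ and
-- unexecuted after t: j* itself, or the earliest-released job of one of the
-- batches X_i met so far.  Hence each X_i is full with all deadlines ≤ τ, which
-- gives |S̃(X*)| = 1 + (B_{k-1} - 1) (j* is still waiting, so not in X_{k-1})
-- and the containment of the windows [r_j, d_j] in Ĩ(X*).
module Submission where

open import Defs
open import Data.Nat using (ℕ; zero; suc; _≤_; _<_; _⊓_; _≤?_)
open import Data.Nat.Properties
open import Data.Fin using (Fin; zero; suc)
open import Data.Fin.Subset
  using (Subset; ⁅_⁆; _∪_; _─_; _-_; _⊆_; ∣_∣; inside; outside)
  renaming (_∈_ to _∈ₛ_; _∉_ to _∉ₛ_; ⊥ to ∅)
open import Data.Fin.Subset.Properties
  using (∣⊥∣≡0; ∉⊥; p─q⊆p; p─⊥≡p; x∈p∪q⁻; x∈⁅y⁆⇒x≡y; p⊂q⇒∣p∣<∣q∣; ∪-identityˡ)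
open import Data.Vec using (_∷_)
open import Data.Vec.Base using (here; there)
open import Data.Vec.Properties using ([]=⇒lookup; lookup∘tabulate)
open import Data.List using (List; []; _++_; [_])
open import Data.List.Membership.Propositional using () renaming (_∈_ to _∈ₗ_)
open import Data.List.Membership.Propositional.Properties using (∈-++⁻)
open import Data.List.Relation.Unary.Any using (here)
open import Data.Maybe using (Maybe; just; nothing)
open import Data.Bool.Properties using (T-≡)
open import Data.Product using (Σ; _×_; _,_; proj₁; proj₂)
open import Data.Sum using (_⊎_; inj₁; inj₂; [_,_]′)
open import Data.Unit using (⊤; tt)
open import Data.Empty using (⊥-elim) renaming (⊥ to Empty)
open import Function.Bundles using (Equivalence)
open import Relation.Nullary using (yes; no; ¬_)
open import Relation.Nullary.Decidable using (⌊_⌋; toWitness)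
open import Relation.Binary.PropositionalEquality using (_≡_; refl; sym; trans; cong; subst)
import Data.Nat as N

x∈p─q⇒x∉q : ∀ {m} {x : Fin m} (p q : Subset m) → x ∈ₛ p ─ q → x ∉ₛ q
x∈p─q⇒x∉q (_ ∷ p) (outside ∷ q) here ()
x∈p─q⇒x∉q (_ ∷ p) (_ ∷ q) (there x∈) (there x∈q) = x∈p─q⇒x∉q p q x∈ x∈q

∣⁅x⁆∪p∣≡1+∣p∣ : ∀ {m} (x : Fin m) (p : Subset m) → x ∉ₛ p → ∣ ⁅ x ⁆ ∪ p ∣ ≡ suc ∣ p ∣
∣⁅x⁆∪p∣≡1+∣p∣ zero    (outside ∷ p) _   = cong (λ q → suc ∣ q ∣) (∪-identityˡ p)
∣⁅x⁆∪p∣≡1+∣p∣ zero    (inside ∷ p)  x∉p = ⊥-elim (x∉p here)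
∣⁅x⁆∪p∣≡1+∣p∣ (suc x) (outside ∷ p) x∉p = ∣⁅x⁆∪p∣≡1+∣p∣ x p (λ x∈ → x∉p (there x∈))
∣⁅x⁆∪p∣≡1+∣p∣ (suc x) (inside ∷ p)  x∉p = cong suc (∣⁅x⁆∪p∣≡1+∣p∣ x p (λ x∈ → x∉p (there x∈)))

x∈p⇒1+∣p-x∣≡∣p∣ : ∀ {m} (p : Subset m) (x : Fin m) → x ∈ₛ p → suc ∣ p - x ∣ ≡ ∣ p ∣
x∈p⇒1+∣p-x∣≡∣p∣ (inside ∷ p)  zero    here       = cong (λ q → suc ∣ q ∣) (p─⊥≡p p)
x∈p⇒1+∣p-x∣≡∣p∣ (outside ∷ p) (suc x) (there x∈) = x∈p⇒1+∣p-x∣≡∣p∣ p x x∈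
x∈p⇒1+∣p-x∣≡∣p∣ (inside ∷ p)  (suc x) (there x∈) = cong suc (x∈p⇒1+∣p-x∣≡∣p∣ p x x∈)

m⊓n≤o∧m≰o⇒n≤o : ∀ {m n o} → m ⊓ n ≤ o → ¬ m ≤ o → n ≤ o
m⊓n≤o∧m≰o⇒n≤o {m} {n} m⊓n≤o m≰o with ⊓-sel m n
... | inj₁ m⊓n≡m = ⊥-elim (m≰o (subst (_≤ _) m⊓n≡m m⊓n≤o))
... | inj₂ m⊓n≡n = subst (_≤ _) m⊓n≡n m⊓n≤o

m≡n⊓o∧m<o⇒m≡n : ∀ {m n o} → m ≡ n ⊓ o → m < o → m ≡ n
m≡n⊓o∧m<o⇒m≡n {n = n} {o} m≡n⊓o m<o with ⊓-sel n o
... | inj₁ n⊓o≡n = trans m≡n⊓o n⊓o≡n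
... | inj₂ n⊓o≡o = ⊥-elim (<-irrefl (trans m≡n⊓o n⊓o≡o) m<o)

∈-++-[]⁻ : ∀ {A : Set} {x y : A} (xs : List A) → y ∈ₗ xs ++ [ x ] → y ∈ₗ xs ⊎ y ≡ x
∈-++-[]⁻ xs y∈ with ∈-++⁻ xs y∈
... | inj₁ y∈xs       = inj₁ y∈xs
... | inj₂ (here y≡x) = inj₂ y≡x

module Algorithm (n : ℕ) (r d : Fin n → ℕ) (B : ℕ → ℕ) where
  open Algo n r d B

  releasedAt⇒r≡ : ∀ {j t} → j ∈ₛ releasedAt t → r j ≡ t
  releasedAt⇒r≡ {j} {t} j∈ = toWitness (Equivalence.from T-≡
    (trans (sym (lookup∘tabulate (λ i → ⌊ r i N.≟ t ⌋) j)) ([]=⇒lookup j∈)))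

  ∈-∪-releasedAt⁻ : ∀ {j t} (W : Subset n) → j ∈ₛ W ∪ releasedAt t → j ∈ₛ W ⊎ r j ≡ t
  ∈-∪-releasedAt⁻ {t = t} W j∈ with x∈p∪q⁻ W (releasedAt t) j∈
  ... | inj₁ j∈W   = inj₁ j∈W
  ... | inj₂ j∈rel = inj₂ (releasedAt⇒r≡ j∈rel)

  PendingAfter : Fin n → Subset n → List (Batch n) → ℕ → Set
  PendingAfter w W 𝒳 t =
    w ∈ₛ W ⊎ Σ (Batch n) λ Z → Z ∈ₗ 𝒳 × w ∈ₛ jobs Z × t < time Z

  Saturated : Batch n → Subset n → List (Batch n) → Set
  Saturated Y W 𝒳 = ∀ w → r w ≤ time Y → PendingAfter w W 𝒳 (time Y) →
                    ∣ jobs Y ∣ ≡ B (type Y) × (∀ j → j ∈ₛ jobs Y → d j ≤ d w)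

  StilSpec : Batch n → Set
  StilSpec X = ((∀ k → type X ≡ suc k → ∣ Stil X ∣ ≡ B k) × (type X ≡ 0 → ∣ Stil X ∣ ≡ 1)) ×
               (∀ j → j ∈ₛ Stil X → Ilo X ≤ r j × d j ≤ Ihi X)

  record Invariant (st : State n) : Set where
    field
      executed-by-now        : ∀ Y → Y ∈ₗ created st → time Y ≤ now st
      waiting-released       : ∀ j → j ∈ₛ waiting st → r j ≤ now st
      executed-after-release : ∀ Y → Y ∈ₗ created st → ∀ j → j ∈ₛ jobs Y → r j ≤ time Y
      waiting-unexecuted     : ∀ Y → Y ∈ₗ created st → ∀ j → j ∈ₛ waiting st → j ∉ₛ jobs Y
      crit∈jobs              : ∀ Y → Y ∈ₗ created st → crit Y ∈ₛ jobs Y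
      saturated              : ∀ Y → Y ∈ₗ created st → Saturated Y (waiting st) (created st)
      stilSpec               : ∀ Y → Y ∈ₗ created st → StilSpec Y

  module Subroutine {τ W 𝒳} (I : Invariant ⟨ τ , W , 𝒳 ⟩)
                    (j* : Fin n) (j*∈W : j* ∈ₛ W) (dj*≡τ : d j* ≡ τ) where
    open Invariant I

    Covered : ℕ → Set
    Covered lo = ∀ t → lo ≤ t → t ≤ τ →
                 Σ (Fin n) λ w → r w ≤ t × d w ≤ τ × PendingAfter w W 𝒳 t

    covered⇒saturated : ∀ {lo} → Covered lo → ∀ X → X ∈ₗ 𝒳 → lo ≤ time X →
                        ∣ jobs X ∣ ≡ B (type X) × (∀ j → j ∈ₛ jobs X → d j ≤ τ)
    covered⇒saturated cov X X∈ lo≤τX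
      with cov (time X) lo≤τX (executed-by-now X X∈)
    ... | w , rw≤τX , dw≤τ , pending with saturated X X∈ w rw≤τX pending
    ... | full , edf = full , λ j j∈ → ≤-trans (edf j j∈) dw≤τ

    covered-extend : ∀ {lo τ'} X → X ∈ₗ 𝒳 → lo ≤ time X → EarliestRelease (jobs X) τ' →
                     Covered lo → Covered (lo ⊓ τ')
    covered-extend {lo} X X∈ lo≤τX ((w , w∈ , rw≡τ') , _) cov t lo⊓τ'≤t t≤τ with lo ≤? t
    ... | yes lo≤t = cov t lo≤t t≤τ
    ... | no lo≰t  = w , subst (_≤ t) (sym rw≡τ') (m⊓n≤o∧m≰o⇒n≤o lo⊓τ'≤t lo≰t)
                       , proj₂ (covered⇒saturated cov X X∈ lo≤τX) w w∈
                       , inj₂ (X , X∈ , w∈ , <-≤-trans (≰⇒> lo≰t) lo≤τX)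

    PrevSpec : ℕ → Maybe (Batch n) → ℕ → Set
    PrevSpec zero    nothing  lo = ⊤
    PrevSpec zero    (just _) lo = Empty
    PrevSpec (suc k) nothing  lo = Empty
    PrevSpec (suc k) (just X) lo = X ∈ₗ 𝒳 × type X ≡ k × ∣ jobs X ∣ ≡ B k ×
                                   (∀ j → j ∈ₛ jobs X → lo ≤ r j × d j ≤ τ)

    LoopInvariant : ℕ → ℕ → ℕ → Maybe (Batch n) → Set
    LoopInvariant k lo hi prev = lo ≤ r j* × τ ≤ hi × Covered lo × PrevSpec k prev lo

    loop-initial : LoopInvariant 0 (r j*) τ nothing
    loop-initial = ≤-refl , ≤-refl , (λ t rj*≤t _ → j* , rj*≤t , ≤-reflexive dj*≡τ , inj₁ j*∈W) , tt

    loop-preserves : ∀ {k lo hi prev k' lo' hi' prev'} → Loop 𝒳 k lo hi prev k' lo' hi' prev' →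
                     LoopInvariant k lo hi prev → LoopInvariant k' lo' hi' prev'
    loop-preserves (stop _) inv = inv
    loop-preserves {lo = lo} {hi} (step X τ' X∈ (refl , lo≤τX , _) _ earliest rest)
                   (lo≤rj* , τ≤hi , cov , _) =
      loop-preserves rest
        ( ≤-trans (m⊓n≤m lo τ') lo≤rj*
        , ≤-trans τ≤hi (m≤m⊔n hi (time X))
        , covered-extend X X∈ lo≤τX earliest cov
        , X∈ , refl , full
        , λ j j∈ → ≤-trans (m⊓n≤n lo τ') (proj₂ earliest j j∈) , due j j∈ )
      where
        full = proj₁ (covered⇒saturated cov X X∈ lo≤τX)
        due  = proj₂ (covered⇒saturated cov X X∈ lo≤τX)

    S̃ : Maybe (Batch n) → Subset n
    S̃ prev = ⁅ j* ⁆ ∪ nonCriticalPrev prev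

    ∣S̃∣ : ∀ k lo prev → PrevSpec k prev lo →
          (∀ k₀ → k ≡ suc k₀ → ∣ S̃ prev ∣ ≡ B k₀) × (k ≡ 0 → ∣ S̃ prev ∣ ≡ 1)
    ∣S̃∣ zero lo nothing tt =
      (λ _ ()) , λ _ → trans (∣⁅x⁆∪p∣≡1+∣p∣ j* ∅ ∉⊥) (cong suc (∣⊥∣≡0 n))
    ∣S̃∣ (suc k) lo (just X) (X∈ , _ , full , _) = (λ { _ refl → card }) , λ ()
      where
        j*∉ : j* ∉ₛ nonCritical X
        j*∉ j*∈ = waiting-unexecuted X X∈ j* j*∈W (p─q⊆p (jobs X) ⁅ crit X ⁆ j*∈)
        card : ∣ S̃ (just X) ∣ ≡ B k
        card = trans (∣⁅x⁆∪p∣≡1+∣p∣ j* (nonCritical X) j*∉)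
                     (trans (x∈p⇒1+∣p-x∣≡∣p∣ (jobs X) (crit X) (crit∈jobs X X∈)) full)

    S̃⊆window : ∀ k lo hi prev → LoopInvariant k lo hi prev →
               ∀ j → j ∈ₛ S̃ prev → lo ≤ r j × d j ≤ hi
    S̃⊆window k lo hi prev (lo≤rj* , τ≤hi , _ , _) j j∈ with x∈p∪q⁻ ⁅ j* ⁆ (nonCriticalPrev prev) j∈
    ... | inj₁ j∈⁅j*⁆ rewrite x∈⁅y⁆⇒x≡y j* j∈⁅j*⁆ = lo≤rj* , subst (_≤ hi) (sym dj*≡τ) τ≤hi
    S̃⊆window zero    lo hi nothing  _ j j∈ | inj₂ j∈∅ = ⊥-elim (∉⊥ j∈∅)
    S̃⊆window (suc k) lo hi (just X) (_ , τ≤hi , _ , (_ , _ , _ , window)) j j∈ | inj₂ j∈X =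
      proj₁ w , ≤-trans (proj₂ w) τ≤hi
      where w = window j (p─q⊆p (jobs X) ⁅ crit X ⁆ j∈X)

    subroutine-sound : ∀ {k lo hi prev} → Loop 𝒳 0 (r j*) τ nothing k lo hi prev →
                       ∀ J → StilSpec (mkBatch j* J k τ lo hi (S̃ prev))
    subroutine-sound {k} {lo} {hi} {prev} loop _ with loop-preserves loop loop-initial
    ... | inv@(_ , _ , _ , spec) = ∣S̃∣ k lo prev spec , S̃⊆window k lo hi prev inv

  invariant-init : Invariant ⟨ 0 , releasedAt 0 , [] ⟩
  invariant-init = record
    { executed-by-now        = λ _ ()
    ; waiting-released       = λ _ j∈ → ≤-reflexive (releasedAt⇒r≡ j∈)
    ; executed-after-release = λ _ ()
    ; waiting-unexecuted     = λ _ ()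
    ; crit∈jobs              = λ _ ()
    ; saturated              = λ _ ()
    ; stilSpec               = λ _ ()
    }

  invariant-advance : ∀ {τ W 𝒳} → Invariant ⟨ τ , W , 𝒳 ⟩ →
                      Invariant ⟨ suc τ , W ∪ releasedAt (suc τ) , 𝒳 ⟩
  invariant-advance {τ} {W} {𝒳} I = record
    { executed-by-now        = λ Y Y∈ → m≤n⇒m≤1+n (executed-by-now Y Y∈)
    ; waiting-released       = λ j j∈ →
        [ (λ j∈W → m≤n⇒m≤1+n (waiting-released j j∈W)) , ≤-reflexive ]′ (∈-∪-releasedAt⁻ W j∈)
    ; executed-after-release = executed-after-release
    ; waiting-unexecuted     = λ Y Y∈ j j∈ j∈Y →
        [ (λ j∈W → waiting-unexecuted Y Y∈ j j∈W j∈Y)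
        , (λ rj≡1+τ → unreleased rj≡1+τ (≤τY⇒≤τ Y Y∈ (executed-after-release Y Y∈ j j∈Y)))
        ]′ (∈-∪-releasedAt⁻ W j∈)
    ; crit∈jobs              = crit∈jobs
    ; saturated              = saturated′
    ; stilSpec               = stilSpec
    }
    where
      open Invariant I
      unreleased : ∀ {j} → r j ≡ suc τ → ¬ r j ≤ τ
      unreleased rj≡1+τ rj≤τ = 1+n≰n (subst (_≤ τ) rj≡1+τ rj≤τ)
      ≤τY⇒≤τ : ∀ Y → Y ∈ₗ 𝒳 → ∀ {t} → t ≤ time Y → t ≤ τ
      ≤τY⇒≤τ Y Y∈ t≤τY = ≤-trans t≤τY (executed-by-now Y Y∈)
      saturated′ : ∀ Y → Y ∈ₗ 𝒳 → Saturated Y (W ∪ releasedAt (suc τ)) 𝒳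
      saturated′ Y Y∈ w rw≤τY (inj₂ executed) = saturated Y Y∈ w rw≤τY (inj₂ executed)
      saturated′ Y Y∈ w rw≤τY (inj₁ w∈) =
        [ (λ w∈W → saturated Y Y∈ w rw≤τY (inj₁ w∈W))
        , (λ rw≡1+τ → ⊥-elim (unreleased rw≡1+τ (≤τY⇒≤τ Y Y∈ rw≤τY)))
        ]′ (∈-∪-releasedAt⁻ W w∈)

  invariant-batch : ∀ {τ W 𝒳} → Invariant ⟨ τ , W , 𝒳 ⟩ →
                    (j* : Fin n) → j* ∈ₛ W → d j* ≡ τ →
                    ∀ {k lo hi prev} → Loop 𝒳 0 (r j*) τ nothing k lo hi prev →
                    (J : Subset n) → J ⊆ W → j* ∈ₛ J → ∣ J ∣ ≡ B k ⊓ ∣ W ∣ →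
                    (∀ i i' → i ∈ₛ J → i' ∈ₛ W → i' ∉ₛ J → d i ≤ d i') →
                    Invariant ⟨ τ , W ─ J
                              , 𝒳 ++ [ mkBatch j* J k τ lo hi (⁅ j* ⁆ ∪ nonCriticalPrev prev) ] ⟩
  invariant-batch {τ} {W} {𝒳} I j* j*∈W dj*≡τ {k} {lo} {hi} {prev} loop J J⊆W j*∈J ∣J∣≡ edf = record
    { executed-by-now        = λ Y Y∈ → cases Y∈ (executed-by-now Y) (λ { refl → ≤-refl })
    ; waiting-released       = λ j j∈ → waiting-released j (W─J⊆W j∈)
    ; executed-after-release = λ Y Y∈ → cases Y∈ (executed-after-release Y)
                                                 (λ { refl j j∈J → waiting-released j (J⊆W j∈J) })
    ; waiting-unexecuted     = λ Y Y∈ j j∈ → cases Y∈ (λ Y∈𝒳 → waiting-unexecuted Y Y∈𝒳 j (W─J⊆W j∈))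
                                                       (λ { refl → x∈p─q⇒x∉q W J j∈ })
    ; crit∈jobs              = λ Y Y∈ → cases Y∈ (crit∈jobs Y) (λ { refl → j*∈J })
    ; saturated              = λ Y Y∈ → cases Y∈ (saturated-old Y) (λ { refl → saturated-new })
    ; stilSpec               = λ Y Y∈ → cases Y∈ (stilSpec Y)
                                                 (λ { refl → Subroutine.subroutine-sound I j* j*∈W dj*≡τ loop J })
    }
    where
      open Invariant I
      X* = mkBatch j* J k τ lo hi (⁅ j* ⁆ ∪ nonCriticalPrev prev)
      cases : ∀ {Y} {C : Set} → Y ∈ₗ 𝒳 ++ [ X* ] → (Y ∈ₗ 𝒳 → C) → (Y ≡ X* → C) → C
      cases Y∈ old new = [ old , new ]′ (∈-++-[]⁻ 𝒳 Y∈)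
      W─J⊆W : W ─ J ⊆ W
      W─J⊆W = p─q⊆p W J
      saturated-old : ∀ Y → Y ∈ₗ 𝒳 → Saturated Y (W ─ J) (𝒳 ++ [ X* ])
      saturated-old Y Y∈ w rw≤τY (inj₁ w∈) = saturated Y Y∈ w rw≤τY (inj₁ (W─J⊆W w∈))
      saturated-old Y Y∈ w rw≤τY (inj₂ (Z , Z∈ , w∈Z , τY<τZ)) =
        cases Z∈ (λ Z∈𝒳 → saturated Y Y∈ w rw≤τY (inj₂ (Z , Z∈𝒳 , w∈Z , τY<τZ)))
                 (λ { refl → saturated Y Y∈ w rw≤τY (inj₁ (J⊆W w∈Z)) })
      -- A waiting job left out of J shows ∣ J ∣ < ∣ W ∣, so the minimum defining ∣ J ∣ is B k.
      saturated-new : Saturated X* (W ─ J) (𝒳 ++ [ X* ])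
      saturated-new w _ (inj₁ w∈) =
        m≡n⊓o∧m<o⇒m≡n ∣J∣≡ (p⊂q⇒∣p∣<∣q∣ (J⊆W , w , W─J⊆W w∈ , x∈p─q⇒x∉q W J w∈)) ,
        λ j j∈J → edf j w j∈J (W─J⊆W w∈) (x∈p─q⇒x∉q W J w∈)
      saturated-new w _ (inj₂ (Z , Z∈ , _ , τ<τZ)) =
        cases Z∈ (λ Z∈𝒳 → ⊥-elim (<⇒≱ τ<τZ (executed-by-now Z Z∈𝒳)))
                 (λ { refl → ⊥-elim (<-irrefl refl τ<τZ) })

  invariant : ∀ {st} → Reachable st → Invariant st
  invariant init = invariant-init
  invariant (advance R _) = invariant-advance (invariant R)
  invariant (batch R j* j*∈W dj*≡τ _ _ _ _ loop J J⊆W j*∈J ∣J∣≡ edf) =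
    invariant-batch (invariant R) j* j*∈W dj*≡τ loop J J⊆W j*∈J ∣J∣≡ edf

lemma3 : (n : ℕ) (r d : Fin n → ℕ) → (∀ j → r j ≤ d j) →
         (B : ℕ → ℕ) → (∀ k → 0 < B k) → (∀ k → B k < B (suc k)) →
         (st : State n) → Algo.Reachable n r d B st →
         (X : Batch n) → X ∈ₗ created st →
         ((∀ k → type X ≡ suc k → ∣ Stil X ∣ ≡ B k) ×
          (type X ≡ 0 → ∣ Stil X ∣ ≡ 1)) ×
         (∀ j → j ∈ₛ Stil X → (Ilo X ≤ r j) × (d j ≤ Ihi X))
lemma3 n r d _ B _ _ st R = Invariant.stilSpec (invariant R)
  where open Algorithm n r d B
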